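{- Let $\mathbf{x}$ be an infinite binary word over $\{0,1\}$, and let $w$ and $w'$ be distinct subwords of $\mathbf{x}$ of equal length such that $w \sim_{\textsf{t}} w'$. Suppose $w$ and $w'$ each contain at least one $1$, and write $w = uv$ and $w' = u'v$, where both $u$ and $u'$ contain exactly one $1$. Let $z$ be the longest common suffix of $u$ and $u'$. Then $zv$ is a left special subword of $\mathbf{x}$.
   Context: "Subword" means factor, i.e., a contiguous block of consecutive letters. The alphabet is totally ordered with $0<1$. The Defant–Kravitz map $\textsf{tortoise}$ on finite words over a totally ordered alphabet is defined recursively: $\textsf{tortoise}(\varepsilon)=\varepsilon$; for a nonempty word $w$ whose largest letter $n$ occurs $k$ times, write $w = A_1 n A_2 n \cdots n A_{k+1}$ (each $A_i$ possibly empty, with all letters of $A_i$ smaller than $n$), and set $\textsf{tortoise}(w) = \textsf{tortoise}(A_1)\,\textsf{tortoise}(A_2)\, n\, \textsf{tortoise}(A_3)\, n \cdots n\, \textsf{tortoise}(A_k)\, n\, \textsf{tortoise}(A_{k+1})\, n$. Two words $w,v$ are tortoise-equivalent, written $w \sim_{\textsf{t}} v$, if $\textsf{tortoise}(w)=\textsf{tortoise}(v)$. A subword $y$ of $\mathbf{x}$ is left special if there are distinct letters $a,b$ such that both $ay$ and $by$ are subwords of $\mathbf{x}$. -}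

module Defs where

open import Data.Nat using (ℕ; zero; suc; _+_; _⊔_; _≟_)
open import Data.List using (List; []; _∷_; _++_; map; length; reverse; foldr; concatMap; upTo; [_])
open import Data.Product using (Σ; ∃; _×_; _,_)
open import Relation.Nullary using (¬_; yes; no)
open import Relation.Binary.PropositionalEquality using (_≡_)

-- Letters are natural numbers with their usual total order; binary words use 0 and 1.

-- largest letter of a word (only used on nonempty words)
maxLetter : List ℕ → ℕ
maxLetter = foldr _⊔_ 0

-- split w at every occurrence of n:  w = A₁ n A₂ n ⋯ n A_{k+1}
-- returns (A₁ , [A₂ , … , A_{k+1}])
splitAt : ℕ → List ℕ → List ℕ × List (List ℕ)
splitAt n [] = [] , []
splitAt n (a ∷ w) with a ≟ n | splitAt n w
... | yes _ | (B , Bs) = [] , (B ∷ Bs)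
... | no _  | (B , Bs) = (a ∷ B) , Bs

-- tortoise with fuel; fuel ≥ length of the word suffices since every A_i is shorter
tortoiseF : ℕ → List ℕ → List ℕ
tortoiseF zero _ = []
tortoiseF (suc f) [] = []
tortoiseF (suc f) w@(_ ∷ _) with splitAt (maxLetter w) w
... | (A₁ , rest) = tortoiseF f A₁ ++ concatMap (λ B → tortoiseF f B ++ [ maxLetter w ]) rest

tortoise : List ℕ → List ℕ
tortoise w = tortoiseF (length w) w

_∼t_ : List ℕ → List ℕ → Set
w ∼t v = tortoise w ≡ tortoise v

factorAt : (ℕ → ℕ) → ℕ → ℕ → List ℕ
factorAt x i m = map (λ j → x (i + j)) (upTo m)

IsSubword : (ℕ → ℕ) → List ℕ → Set
IsSubword x w = ∃ λ i → w ≡ factorAt x i (length w)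

LeftSpecial : (ℕ → ℕ) → List ℕ → Set
LeftSpecial x y = ∃ λ a → ∃ λ b → ¬ (a ≡ b) × IsSubword x (a ∷ y) × IsSubword x (b ∷ y)

count1 : List ℕ → ℕ
count1 [] = 0
count1 (a ∷ w) with a ≟ 1
... | yes _ = suc (count1 w)
... | no _  = count1 w

lcp : List ℕ → List ℕ → List ℕ
lcp (a ∷ u) (b ∷ v) with a ≟ b
... | yes _ = a ∷ lcp u v
... | no _  = []
lcp _ _ = []

lcs : List ℕ → List ℕ → List ℕ
lcs u v = reverse (lcp (reverse u) (reverse v))

{-# OPTIONS --safe #-}
module Submission where

-- Only the combinatorics of w = uv, w' = u'v is needed: w ≠ w' of equal length forces u ≠ u' of
-- equal length, so the letters a ≠ b just left of the longest common suffix z of u and u' exist,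
-- and a z v, b z v are suffixes of w, w'.

open import Defs
open import Data.Nat using (ℕ; _≤_; suc; _+_; _≟_)
open import Data.Nat.Properties using (+-identityʳ; +-suc; +-cancelʳ-≡; suc-injective)
open import Data.List using (List; []; _∷_; _++_; _∷ʳ_; length; reverse; map; upTo; applyUpTo; [_])
open import Data.List.Properties
  using (map-upTo; map-cong; ∷-injectiveʳ; ++-assoc; length-++; length-reverse; reverse-++; unfold-reverse;
         reverse-selfInverse; reverse-involutive)
open import Data.List.Membership.Propositional using (_∈_)
open import Data.Product using (∃; ∃₂; _×_; _,_)
open import Relation.Nullary using (¬_; yes; no)
open import Relation.Binary.PropositionalEquality using (_≡_; refl; sym; trans; cong; cong₂; subst; module ≡-Reasoning)

factorAt-suc : ∀ x i m → factorAt x i (suc m) ≡ x i ∷ factorAt x (suc i) m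
factorAt-suc x i m = begin
  map (λ j → x (i + j)) (upTo (suc m))            ≡⟨ map-upTo _ (suc m) ⟩
  x (i + 0) ∷ applyUpTo (λ j → x (i + suc j)) m   ≡⟨ cong₂ _∷_ (cong x (+-identityʳ i)) (sym (map-upTo _ m)) ⟩
  x i ∷ map (λ j → x (i + suc j)) (upTo m)        ≡⟨ cong (x i ∷_) (map-cong (λ j → cong x (+-suc i j)) (upTo m)) ⟩
  x i ∷ factorAt x (suc i) m                      ∎
  where open ≡-Reasoning

IsSubword-∷⁻ : ∀ x {a w} → IsSubword x (a ∷ w) → IsSubword x w
IsSubword-∷⁻ x {w = w} (i , eq) = suc i , ∷-injectiveʳ (trans eq (factorAt-suc x i (length w)))

IsSubword-++⁻ʳ : ∀ x u {v} → IsSubword x (u ++ v) → IsSubword x v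
IsSubword-++⁻ʳ x []      sw = sw
IsSubword-++⁻ʳ x (_ ∷ u) sw = IsSubword-++⁻ʳ x u (IsSubword-∷⁻ x sw)

IsSubword-suffix : ∀ x t {s y} v → t ≡ s ++ y → IsSubword x (t ++ v) → IsSubword x (y ++ v)
IsSubword-suffix x _ {s} v refl sw = IsSubword-++⁻ʳ x s (subst (IsSubword x) (++-assoc s _ v) sw)

lcp-mismatch : ∀ r r' → length r ≡ length r' → ¬ r ≡ r' →
  ∃₂ λ a b → ¬ a ≡ b × (∃ λ s → r ≡ lcp r r' ++ a ∷ s) × (∃ λ s' → r' ≡ lcp r r' ++ b ∷ s')
lcp-mismatch []      []       _   r≢r' with () ← r≢r' refl
lcp-mismatch (a ∷ r) (b ∷ r') len r≢r' with a ≟ b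
... | no a≢b = a , b , a≢b , (r , refl) , (r' , refl)
... | yes refl with lcp-mismatch r r' (suc-injective len) (λ r≡r' → r≢r' (cong (a ∷_) r≡r'))
...   | c , d , c≢d , (s , eq) , (s' , eq') = c , d , c≢d , (s , cong (a ∷_) eq) , (s' , cong (a ∷_) eq')

reverse-≡-++-∷ : ∀ {u p : List ℕ} {a s} → reverse u ≡ p ++ a ∷ s → u ≡ reverse s ++ a ∷ reverse p
reverse-≡-++-∷ {u} {p} {a} {s} eq = begin
  u                             ≡⟨ sym (reverse-selfInverse eq) ⟩
  reverse (p ++ a ∷ s)          ≡⟨ reverse-++ p (a ∷ s) ⟩
  reverse (a ∷ s) ++ reverse p  ≡⟨ cong (_++ reverse p) (unfold-reverse a s) ⟩
  (reverse s ∷ʳ a) ++ reverse p ≡⟨ ++-assoc (reverse s) [ a ] (reverse p) ⟩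
  reverse s ++ a ∷ reverse p    ∎
  where open ≡-Reasoning

lcs-mismatch : ∀ u u' → length u ≡ length u' → ¬ u ≡ u' →
  ∃₂ λ a b → ¬ a ≡ b × (∃ λ s → u ≡ s ++ a ∷ lcs u u') × (∃ λ s' → u' ≡ s' ++ b ∷ lcs u u')
lcs-mismatch u u' len u≢u' with lcp-mismatch (reverse u) (reverse u') len-reverse reverse-≢
  where
    len-reverse : length (reverse u) ≡ length (reverse u')
    len-reverse = trans (length-reverse u) (trans len (sym (length-reverse u')))
    reverse-≢ : ¬ reverse u ≡ reverse u'
    reverse-≢ eq = u≢u' (trans (sym (reverse-selfInverse eq)) (reverse-involutive u'))
... | a , b , a≢b , (s , eq) , (s' , eq') =
  a , b , a≢b , (reverse s , reverse-≡-++-∷ eq) , (reverse s' , reverse-≡-++-∷ eq')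

lemma1 : (x : ℕ → ℕ) → (∀ i → x i ≤ 1)
         → (w w' : List ℕ) → IsSubword x w → IsSubword x w'
         → ¬ (w ≡ w') → length w ≡ length w' → w ∼t w'
         → 1 ∈ w → 1 ∈ w'
         → (u u' v : List ℕ) → w ≡ u ++ v → w' ≡ u' ++ v
         → count1 u ≡ 1 → count1 u' ≡ 1
         → LeftSpecial x (lcs u u' ++ v)
lemma1 x _ _ _ sw sw' w≢w' len _ _ _ u u' v refl refl _ _
  with lcs-mismatch u u' len-u u≢u'
  where
    len-u : length u ≡ length u'
    len-u = +-cancelʳ-≡ (length v) (length u) (length u')
              (trans (sym (length-++ u)) (trans len (length-++ u')))
    u≢u' : ¬ u ≡ u'
    u≢u' refl = w≢w' refl
... | a , b , a≢b , (s , eq) , (s' , eq') =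
  a , b , a≢b , IsSubword-suffix x u v eq sw , IsSubword-suffix x u' v eq' sw'
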